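{- Let $q$ be a prime power and let $i,d,k,n$ be integers with $2\leq i\leq d<k$ and $2k\leq n$. For $0\le j\le d$ define $$a_j=\frac{q^{k}-q^{d}}{q^{n}-q^{k}}\left[n-k\atop k\right]_q+(-1)^{j}q^{\binom{j}{2}-kj}\left[n-k-j\atop k-j\right]_q,$$ $$b_j=(-1)^{j}q^{kj+(d-j)^{2}-\binom{j+1}{2}}\left[k-j\atop d-j\right]_q\left[n-d-j\atop d-j\right]_q\left[n-d-j\atop k-d\right]_q.$$ Then $b_i<\dfrac{a_i b_1}{a_1}$.
   Context: Gaussian binomial: $\left[m\atop k\right]_q=\prod_{t=0}^{k-1}\frac{q^{m-t}-1}{q^{k-t}-1}$ for positive integer $k$, $\left[m\atop 0\right]_q=1$, and $0$ for negative integer $k$. -}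

module Defs where

open import Data.Nat as ℕ using (ℕ; zero; suc)
open import Data.Nat.Combinatorics using (_C_)
open import Data.Integer as ℤ using (ℤ; +_; -[1+_])
open import Data.Rational as ℚ using (ℚ; 0ℚ; 1ℚ; _+_; _*_; _-_; -_; 1/_; ≢-nonZero)
open import Data.Rational.Properties using (_≟_)
open import Relation.Nullary using (yes; no)

-- division on ℚ, totalised by x / 0 = 0 (only ever used with nonzero denominators below)
_÷'_ : ℚ → ℚ → ℚ
x ÷' y with y ≟ 0ℚ
... | yes _ = 0ℚ
... | no y≢0 = x * 1/_ y {{≢-nonZero y≢0}}

_^ℕ_ : ℚ → ℕ → ℚ
x ^ℕ zero = 1ℚ
x ^ℕ suc n = x * (x ^ℕ n)

_^ℤ_ : ℚ → ℤ → ℚ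
x ^ℤ (+ n) = x ^ℕ n
x ^ℤ -[1+ n ] = 1ℚ ÷' (x ^ℕ suc n)

prodℚ : ℕ → (ℕ → ℚ) → ℚ
prodℚ zero f = 1ℚ
prodℚ (suc k) f = prodℚ k f * f k

-- Gaussian binomial [m choose k]_q = ∏_{t=0}^{k-1} (q^{m-t} - 1)/(q^{k-t} - 1)
-- (k = 0 gives the empty product 1; negative k never occurs since k : ℕ)
gauss : ℚ → ℤ → ℕ → ℚ
gauss q m k = prodℚ k (λ t → (q ^ℤ (m ℤ.- + t) - 1ℚ) ÷' (q ^ℤ (+ k ℤ.- + t) - 1ℚ))

ℚof : ℕ → ℚ
ℚof n = + n ℚ./ 1

open import Data.Nat.Primality using (Prime)
open import Data.Product using (Σ; _×_)
IsPrimePower : ℕ → Set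
IsPrimePower q = Σ ℕ λ p → Σ ℕ λ m → Prime p × (1 ℕ.≤ m) × (q ≡ p ℕ.^ m)
  where open import Relation.Binary.PropositionalEquality using (_≡_)

module _ (q d k n : ℕ) where
  private
    Q = ℚof q
    z : ℕ → ℤ
    z = +_
    sgn : ℕ → ℚ
    sgn j = (- 1ℚ) ^ℕ j

  aj : ℕ → ℚ
  aj j = ((Q ^ℕ k - Q ^ℕ d) ÷' (Q ^ℕ n - Q ^ℕ k)) * gauss Q (z n ℤ.- z k) k
       + sgn j * (Q ^ℤ (z (j C 2) ℤ.- z (k ℕ.* j))) * gauss Q (z n ℤ.- z k ℤ.- z j) (k ℕ.∸ j)

  bj : ℕ → ℚ
  bj j = sgn j * (Q ^ℤ (z (k ℕ.* j) ℤ.+ (z d ℤ.- z j) ℤ.* (z d ℤ.- z j) ℤ.- z (suc j C 2)))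
       * gauss Q (z k ℤ.- z j) (d ℕ.∸ j)
       * gauss Q (z n ℤ.- z d ℤ.- z j) (d ℕ.∸ j)
       * gauss Q (z n ℤ.- z d ℤ.- z j) (k ℕ.∸ d)

module Submission where

-- Put N = n - k, h_j = [N-j, k-j]_q and κ = c (q^N - 1)/(q^k - 1) with c = (q^k - q^d)/(q^n - q^k), so that
-- c [N, k]_q = κ h_1. Then a_1 = (κ - q^(-k)) h_1 and a_i = κ h_1 + (-1)^i q^(C(i,2) - ki) h_i, while
-- b_j = (-1)^j B_j with B_j > 0. Since κ q^k (q^k - 1) = q^k - q^d, the bounds q^(C(i,2) - ki) < κ < q^(-k) < 2κ
-- follow from q ≥ 2 and d < k; with h_i ≤ h_1 they give a_1 < 0 < a_i, and -a_1 < a_i for even i.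
-- Comparing the factors of B_i and B_1 one at a time gives B_i ≤ B_1. Multiplied by -a_1 > 0 the claim reads
-- b_i (-a_1) < a_i B_1: for odd i the left side is ≤ 0, for even i it is at most B_1 (-a_1) < B_1 a_i.

open import Defs
open import Data.Nat as ℕ using (ℕ; zero; suc)
import Data.Nat.Properties as ℕₚ
open import Data.Nat.Combinatorics using (_C_)
open import Data.Integer as ℤ using (ℤ; +_; -[1+_])
import Data.Integer.Properties as ℤₚ
open import Data.Rational as ℚ using (ℚ; 0ℚ; 1ℚ)
import Data.Rational.Properties as ℚₚ
open import Data.Rational.Solver using (module +-*-Solver)
open import Data.Product using (_,_; _×_)
open import Data.Sum using (_⊎_; inj₁; inj₂)
open import Data.Empty using (⊥-elim)
open import Relation.Binary.PropositionalEquality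
open import Relation.Nullary using (yes; no)
import Data.Integer.Tactic.RingSolver as ℤ-Ring

+m-+n≡+[m∸n] : ∀ {m n} → n ℕ.≤ m → + m ℤ.- + n ≡ + (m ℕ.∸ n)
+m-+n≡+[m∸n] {m} {n} n≤m = trans (ℤₚ.m-n≡m⊖n m n) (ℤₚ.⊖-≥ n≤m)

≤-via-+ : ∀ {x y m A B} → x ℤ.+ + m ≡ + A → y ℤ.+ + m ≡ + B → A ℕ.≤ B → x ℤ.≤ y
≤-via-+ {x} {y} {m} x+m≡A y+m≡B A≤B = subst₂ ℤ._≤_ (cancel x (+ m)) (cancel y (+ m))
  (subst₂ (λ u v → u ℤ.- + m ℤ.≤ v ℤ.- + m) (sym x+m≡A) (sym y+m≡B) (ℤₚ.+-monoˡ-≤ (ℤ.- + m) (ℤ.+≤+ A≤B)))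
  where
  cancel : ∀ (u m : ℤ) → u ℤ.+ m ℤ.- m ≡ u
  cancel = ℤ-Ring.solve-∀

module RationalLemmas where
  open import Data.Rational using (_+_; _*_; _-_; -_; _≤_; _<_)

  *-pos : ∀ {x y} → 0ℚ < x → 0ℚ < y → 0ℚ < x * y
  *-pos {x} {y} 0<x 0<y =
    ℚₚ.positive⁻¹ (x * y) {{ℚₚ.pos*pos⇒pos x {{ℚ.positive 0<x}} y {{ℚ.positive 0<y}}}}

  *-nonNeg : ∀ {x y} → 0ℚ ≤ x → 0ℚ ≤ y → 0ℚ ≤ x * y
  *-nonNeg {x} {y} 0≤x 0≤y =
    ℚₚ.nonNegative⁻¹ (x * y) {{ℚₚ.nonNeg*nonNeg⇒nonNeg x {{ℚ.nonNegative 0≤x}} y {{ℚ.nonNegative 0≤y}}}}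

  *-monoʳ-≤-nonNeg′ : ∀ {x y} r → 0ℚ ≤ r → x ≤ y → x * r ≤ y * r
  *-monoʳ-≤-nonNeg′ r 0≤r = ℚₚ.*-monoʳ-≤-nonNeg r {{ℚ.nonNegative 0≤r}}

  *-monoˡ-≤-nonNeg′ : ∀ {x y} r → 0ℚ ≤ r → x ≤ y → r * x ≤ r * y
  *-monoˡ-≤-nonNeg′ r 0≤r = ℚₚ.*-monoˡ-≤-nonNeg r {{ℚ.nonNegative 0≤r}}

  *-monoˡ-<-pos′ : ∀ {x y} r → 0ℚ < r → x < y → x * r < y * r
  *-monoˡ-<-pos′ r 0<r = ℚₚ.*-monoˡ-<-pos r {{ℚ.positive 0<r}}

  *-monoʳ-<-pos′ : ∀ {x y} r → 0ℚ < r → x < y → r * x < r * y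
  *-monoʳ-<-pos′ r 0<r = ℚₚ.*-monoʳ-<-pos r {{ℚ.positive 0<r}}

  *-cancelʳ-≤-pos′ : ∀ {x y} r → 0ℚ < r → x * r ≤ y * r → x ≤ y
  *-cancelʳ-≤-pos′ r 0<r = ℚₚ.*-cancelʳ-≤-pos r {{ℚ.positive 0<r}}

  *-cancelʳ-<-pos′ : ∀ {x y} r → 0ℚ < r → x * r < y * r → x < y
  *-cancelʳ-<-pos′ r 0<r = ℚₚ.*-cancelʳ-<-nonNeg r {{ℚ.nonNegative (ℚₚ.<⇒≤ 0<r)}}

  *-mono-≤-nonNeg : ∀ {a b c d} → 0ℚ ≤ a → 0ℚ ≤ c → a ≤ b → c ≤ d → a * c ≤ b * d
  *-mono-≤-nonNeg {a} {b} {c} {d} 0≤a 0≤c a≤b c≤d =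
    ℚₚ.≤-trans (*-monoʳ-≤-nonNeg′ c 0≤c a≤b) (*-monoˡ-≤-nonNeg′ b (ℚₚ.≤-trans 0≤a a≤b) c≤d)

  p<q⇒0<q-p : ∀ {p q} → p < q → 0ℚ < q - p
  p<q⇒0<q-p {p} {q} h = subst (_< q - p) (ℚₚ.+-inverseʳ p) (ℚₚ.+-monoˡ-< (- p) h)

  p≤q⇒0≤q-p : ∀ {p q} → p ≤ q → 0ℚ ≤ q - p
  p≤q⇒0≤q-p {p} {q} h = subst (_≤ q - p) (ℚₚ.+-inverseʳ p) (ℚₚ.+-monoˡ-≤ (- p) h)

  p≤p+q : ∀ p {q} → 0ℚ ≤ q → p ≤ p + q
  p≤p+q p {q} 0≤q = subst (_≤ p + q) (ℚₚ.+-identityʳ p) (ℚₚ.+-monoʳ-≤ p 0≤q)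

  0<q-p⇒p<q : ∀ {p q} → 0ℚ < q - p → p < q
  0<q-p⇒p<q {p} {q} h = subst₂ _<_ (ℚₚ.+-identityʳ p) p+[q-p]≡q (ℚₚ.+-monoʳ-< p h)
    where
    open +-*-Solver
    p+[q-p]≡q : p + (q - p) ≡ q
    p+[q-p]≡q = solve 2 (λ p q → p :+ (q :- p) := q) refl p q

  pos⇒≢0 : ∀ {p} → 0ℚ < p → p ≢ 0ℚ
  pos⇒≢0 0<p p≡0 = ℚₚ.<-irrefl (sym p≡0) 0<p

  ÷'-*-cancelʳ : ∀ x y → y ≢ 0ℚ → (x ÷' y) * y ≡ x
  ÷'-*-cancelʳ x y y≢0 with y ℚₚ.≟ 0ℚ
  ... | yes y≡0 = ⊥-elim (y≢0 y≡0)
  ... | no y≢0′ = trans (ℚₚ.*-assoc x _ y)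
                        (trans (cong (x *_) (ℚₚ.*-inverseˡ y {{ℚ.≢-nonZero y≢0′}})) (ℚₚ.*-identityʳ x))

  ÷'-pos : ∀ {x y} → 0ℚ < x → 0ℚ < y → 0ℚ < x ÷' y
  ÷'-pos {x} {y} 0<x 0<y with y ℚₚ.≟ 0ℚ
  ... | yes y≡0 = ⊥-elim (pos⇒≢0 0<y y≡0)
  ... | no _ = *-pos 0<x (ℚₚ.positive⁻¹ _ {{ℚₚ.1/pos⇒pos y {{ℚ.positive 0<y}}}})

  -1^-cases : ∀ i → (- 1ℚ) ^ℕ i ≡ 1ℚ ⊎ (- 1ℚ) ^ℕ i ≡ - 1ℚ
  -1^-cases zero = inj₁ refl
  -1^-cases (suc i) with -1^-cases i
  ... | inj₁ e = inj₂ (cong ((- 1ℚ) *_) e)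
  ... | inj₂ e = inj₁ (cong ((- 1ℚ) *_) e)

  prodℚ-suc-first : ∀ K f → prodℚ (suc K) f ≡ f 0 * prodℚ K (λ t → f (suc t))
  prodℚ-suc-first zero f = trans (ℚₚ.*-identityˡ (f 0)) (sym (ℚₚ.*-identityʳ (f 0)))
  prodℚ-suc-first (suc K) f = trans (cong (_* f (suc K)) (prodℚ-suc-first K f)) (ℚₚ.*-assoc (f 0) _ _)

  prodℚ-cong : ∀ K f g → (∀ t → t ℕ.< K → f t ≡ g t) → prodℚ K f ≡ prodℚ K g
  prodℚ-cong zero f g f≗g = refl
  prodℚ-cong (suc K) f g f≗g =
    cong₂ _*_ (prodℚ-cong K f g (λ t t<K → f≗g t (ℕₚ.m<n⇒m<1+n t<K))) (f≗g K (ℕₚ.n<1+n K))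

  <-÷'-neg : ∀ {A B α β} → A < 0ℚ → B < 0ℚ → 0ℚ < α →
             β ≤ 0ℚ ⊎ (β ≤ - B × - A < α) → β < (α * B) ÷' A
  <-÷'-neg {A} {B} {α} {β} A<0 B<0 0<α cases =
    *-cancelʳ-<-pos′ (- A) 0<-A (ℚₚ.<-≤-trans (cleared cases) (ℚₚ.≤-reflexive (sym ratio*-A)))
    where
    0<-A = ℚₚ.neg-antimono-< A<0
    0<-B = ℚₚ.neg-antimono-< B<0
    ratio*-A : (α * B) ÷' A * (- A) ≡ α * (- B)
    ratio*-A = begin
      (α * B) ÷' A * (- A) ≡⟨ ℚₚ.neg-distribʳ-* ((α * B) ÷' A) A ⟨
      - ((α * B) ÷' A * A) ≡⟨ cong -_ (÷'-*-cancelʳ (α * B) A (λ A≡0 → ℚₚ.<-irrefl A≡0 A<0)) ⟩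
      - (α * B)            ≡⟨ ℚₚ.neg-distribʳ-* α B ⟩
      α * (- B)            ∎
      where open ≡-Reasoning
    cleared : β ≤ 0ℚ ⊎ (β ≤ - B × - A < α) → β * (- A) < α * (- B)
    cleared (inj₁ β≤0) = ℚₚ.≤-<-trans
      (ℚₚ.≤-trans (*-monoʳ-≤-nonNeg′ (- A) (ℚₚ.<⇒≤ 0<-A) β≤0) (ℚₚ.≤-reflexive (ℚₚ.*-zeroˡ (- A))))
      (*-pos 0<α 0<-B)
    cleared (inj₂ (β≤-B , -A<α)) = ℚₚ.≤-<-trans (*-monoʳ-≤-nonNeg′ (- A) (ℚₚ.<⇒≤ 0<-A) β≤-B)
      (ℚₚ.<-≤-trans (*-monoʳ-<-pos′ (- B) 0<-B -A<α) (ℚₚ.≤-reflexive (ℚₚ.*-comm (- B) α)))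

module Powers (Q : ℚ) (1<Q : 1ℚ ℚ.< Q) where
  open import Data.Rational using (_+_; _*_; _-_; -_; _≤_; _<_)
  open RationalLemmas
  open +-*-Solver

  0<Q : 0ℚ < Q
  0<Q = ℚₚ.<-trans (ℚₚ.positive⁻¹ 1ℚ) 1<Q

  ^ℕ-distribˡ-+-* : ∀ a b → Q ^ℕ (a ℕ.+ b) ≡ Q ^ℕ a * Q ^ℕ b
  ^ℕ-distribˡ-+-* zero b = sym (ℚₚ.*-identityˡ (Q ^ℕ b))
  ^ℕ-distribˡ-+-* (suc a) b =
    trans (cong (Q *_) (^ℕ-distribˡ-+-* a b)) (sym (ℚₚ.*-assoc Q (Q ^ℕ a) (Q ^ℕ b)))

  ^ℕ-pos : ∀ n → 0ℚ < Q ^ℕ n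
  ^ℕ-pos zero = ℚₚ.positive⁻¹ 1ℚ
  ^ℕ-pos (suc n) = *-pos 0<Q (^ℕ-pos n)

  ^ℕ-nonNeg : ∀ n → 0ℚ ≤ Q ^ℕ n
  ^ℕ-nonNeg n = ℚₚ.<⇒≤ (^ℕ-pos n)

  ^ℕ-<-suc : ∀ n → Q ^ℕ n < Q ^ℕ suc n
  ^ℕ-<-suc n = subst (_< Q ^ℕ suc n) (ℚₚ.*-identityˡ (Q ^ℕ n)) (*-monoˡ-<-pos′ (Q ^ℕ n) (^ℕ-pos n) 1<Q)

  ^ℕ-monoʳ-≤ : ∀ {a b} → a ℕ.≤ b → Q ^ℕ a ≤ Q ^ℕ b
  ^ℕ-monoʳ-≤ a≤b = go (ℕₚ.≤⇒≤′ a≤b)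
    where
    go : ∀ {a b} → a ℕ.≤′ b → Q ^ℕ a ≤ Q ^ℕ b
    go ℕ.≤′-refl = ℚₚ.≤-refl
    go (ℕ.≤′-step {n} a≤′n) = ℚₚ.≤-trans (go a≤′n) (ℚₚ.<⇒≤ (^ℕ-<-suc n))

  ^ℕ-monoʳ-< : ∀ {a b} → a ℕ.< b → Q ^ℕ a < Q ^ℕ b
  ^ℕ-monoʳ-< {a} {suc b} (ℕ.s≤s a≤b) = ℚₚ.≤-<-trans (^ℕ-monoʳ-≤ a≤b) (^ℕ-<-suc b)

  1≤^ℕ : ∀ n → 1ℚ ≤ Q ^ℕ n
  1≤^ℕ n = ^ℕ-monoʳ-≤ {0} {n} ℕ.z≤n

  private
    posPart negPart : ℤ → ℕ
    posPart (+ n) = n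
    posPart -[1+ m ] = 0
    negPart (+ n) = 0
    negPart -[1+ m ] = suc m

    +-negPart : ∀ e → e ℤ.+ + negPart e ≡ + posPart e
    +-negPart (+ n) = ℤₚ.+-identityʳ (+ n)
    +-negPart -[1+ m ] = ℤₚ.+-inverseˡ (+ suc m)

  ^ℤ-*-^ℕ-negPart : ∀ e → Q ^ℤ e * Q ^ℕ negPart e ≡ Q ^ℕ posPart e
  ^ℤ-*-^ℕ-negPart (+ n) = ℚₚ.*-identityʳ (Q ^ℕ n)
  ^ℤ-*-^ℕ-negPart -[1+ m ] = ÷'-*-cancelʳ 1ℚ (Q ^ℕ suc m) (pos⇒≢0 (^ℕ-pos (suc m)))

  ^ℤ-pos : ∀ e → 0ℚ < Q ^ℤ e
  ^ℤ-pos (+ n) = ^ℕ-pos n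
  ^ℤ-pos -[1+ m ] = ÷'-pos (ℚₚ.positive⁻¹ 1ℚ) (^ℕ-pos (suc m))

  ^ℤ-*-^ℕ-clear : ∀ e t u →
    Q ^ℤ e * Q ^ℕ t * Q ^ℕ (negPart e ℕ.+ u) ≡ Q ^ℕ (posPart e ℕ.+ (t ℕ.+ u))
  ^ℤ-*-^ℕ-clear e t u = begin
    Q ^ℤ e * Q ^ℕ t * Q ^ℕ (negPart e ℕ.+ u)
      ≡⟨ cong (Q ^ℤ e * Q ^ℕ t *_) (^ℕ-distribˡ-+-* (negPart e) u) ⟩
    Q ^ℤ e * Q ^ℕ t * (Q ^ℕ negPart e * Q ^ℕ u)
      ≡⟨ solve 4 (λ a b c d → a :* b :* (c :* d) := (a :* c) :* (b :* d)) refl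
                 (Q ^ℤ e) (Q ^ℕ t) (Q ^ℕ negPart e) (Q ^ℕ u) ⟩
    (Q ^ℤ e * Q ^ℕ negPart e) * (Q ^ℕ t * Q ^ℕ u)
      ≡⟨ cong₂ _*_ (^ℤ-*-^ℕ-negPart e) (sym (^ℕ-distribˡ-+-* t u)) ⟩
    Q ^ℕ posPart e * Q ^ℕ (t ℕ.+ u)
      ≡⟨ ^ℕ-distribˡ-+-* (posPart e) (t ℕ.+ u) ⟨
    Q ^ℕ (posPart e ℕ.+ (t ℕ.+ u)) ∎
    where open ≡-Reasoning

  -- Multiplying by q^(negPart e + negPart f) reduces the comparison to natural exponents.
  ^ℤ-*-^ℕ-mono : ∀ e f t t' → e ℤ.+ + t ℤ.≤ f ℤ.+ + t' → Q ^ℤ e * Q ^ℕ t ≤ Q ^ℤ f * Q ^ℕ t'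
  ^ℤ-*-^ℕ-mono e f t t' e+t≤f+t' =
    *-cancelʳ-≤-pos′ (Q ^ℕ (negPart e ℕ.+ negPart f)) (^ℕ-pos (negPart e ℕ.+ negPart f))
      (subst₂ _≤_ (sym (^ℤ-*-^ℕ-clear e t (negPart f)))
                  (sym (trans (cong (λ u → Q ^ℤ f * Q ^ℕ t' * Q ^ℕ u) (ℕₚ.+-comm (negPart e) (negPart f)))
                              (^ℤ-*-^ℕ-clear f t' (negPart e))))
                  (^ℕ-monoʳ-≤ exponents-≤))
    where
    open import Algebra.Properties.CommutativeSemigroup ℤₚ.+-commutativeSemigroup using (interchange)
    shifted : ∀ x s u → + (posPart x ℕ.+ (s ℕ.+ u)) ≡ (x ℤ.+ + s) ℤ.+ (+ negPart x ℤ.+ + u)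
    shifted x s u = begin
      + (posPart x ℕ.+ (s ℕ.+ u))
        ≡⟨ trans (ℤₚ.pos-+ (posPart x) _) (cong (λ y → + posPart x ℤ.+ y) (ℤₚ.pos-+ s u)) ⟩
      + posPart x ℤ.+ (+ s ℤ.+ + u)          ≡⟨ cong (ℤ._+ (+ s ℤ.+ + u)) (+-negPart x) ⟨
      (x ℤ.+ + negPart x) ℤ.+ (+ s ℤ.+ + u)  ≡⟨ interchange x (+ negPart x) (+ s) (+ u) ⟩
      (x ℤ.+ + s) ℤ.+ (+ negPart x ℤ.+ + u)  ∎
      where open ≡-Reasoning
    exponents-≤ : posPart e ℕ.+ (t ℕ.+ negPart f) ℕ.≤ posPart f ℕ.+ (t' ℕ.+ negPart e)
    exponents-≤ = ℤₚ.drop‿+≤+ (subst₂ ℤ._≤_ (sym (shifted e t (negPart f)))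
      (trans (cong (λ y → (f ℤ.+ + t') ℤ.+ y) (ℤₚ.+-comm (+ negPart e) (+ negPart f)))
             (sym (shifted f t' (negPart e))))
      (ℤₚ.+-monoˡ-≤ (+ negPart e ℤ.+ + negPart f) e+t≤f+t'))

  ^ℤ-*-^ℕ-cong : ∀ e f t t' → e ℤ.+ + t ≡ f ℤ.+ + t' → Q ^ℤ e * Q ^ℕ t ≡ Q ^ℤ f * Q ^ℕ t'
  ^ℤ-*-^ℕ-cong e f t t' eq = ℚₚ.≤-antisym (^ℤ-*-^ℕ-mono e f t t' (ℤₚ.≤-reflexive eq))
                                          (^ℤ-*-^ℕ-mono f e t' t (ℤₚ.≤-reflexive (sym eq)))

  factor : ℕ → ℕ → ℚ
  factor a b = (Q ^ℕ a - 1ℚ) ÷' (Q ^ℕ b - 1ℚ)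

  gaussℕ : ℕ → ℕ → ℚ
  gaussℕ M K = prodℚ K (λ t → factor (M ℕ.∸ t) (K ℕ.∸ t))

  gauss≡gaussℕ : ∀ M K → K ℕ.≤ M → gauss Q (+ M) K ≡ gaussℕ M K
  gauss≡gaussℕ M K K≤M = prodℚ-cong K _ _ λ t t<K →
    cong₂ (λ u v → (Q ^ℤ u - 1ℚ) ÷' (Q ^ℤ v - 1ℚ))
      (+m-+n≡+[m∸n] (ℕₚ.≤-trans (ℕₚ.<⇒≤ t<K) K≤M)) (+m-+n≡+[m∸n] (ℕₚ.<⇒≤ t<K))

  gauss-∸ : ∀ {a b} K → b ℕ.≤ a → K ℕ.≤ a ℕ.∸ b → gauss Q (+ a ℤ.- + b) K ≡ gaussℕ (a ℕ.∸ b) K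
  gauss-∸ {a} {b} K b≤a K≤a∸b =
    trans (cong (λ e → gauss Q e K) (+m-+n≡+[m∸n] b≤a)) (gauss≡gaussℕ (a ℕ.∸ b) K K≤a∸b)

  gauss-∸-∸ : ∀ {a b c} K → b ℕ.≤ a → c ℕ.≤ a ℕ.∸ b → K ℕ.≤ a ℕ.∸ b ℕ.∸ c →
    gauss Q (+ a ℤ.- + b ℤ.- + c) K ≡ gaussℕ (a ℕ.∸ b ℕ.∸ c) K
  gauss-∸-∸ {c = c} K b≤a c≤a∸b K≤ =
    trans (cong (λ e → gauss Q (e ℤ.- + c) K) (+m-+n≡+[m∸n] b≤a)) (gauss-∸ K c≤a∸b K≤)

  gaussℕ-suc : ∀ M K → gaussℕ (suc M) (suc K) ≡ factor (suc M) (suc K) * gaussℕ M K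
  gaussℕ-suc M K = prodℚ-suc-first K _

  gaussℕ-unfold : ∀ {M K} → 1 ℕ.≤ K → K ℕ.≤ M →
    gaussℕ M K ≡ factor M K * gaussℕ (M ℕ.∸ 1) (K ℕ.∸ 1)
  gaussℕ-unfold {suc M} {suc K} _ _ = gaussℕ-suc M K

  0<^ℕ-1 : ∀ {b} → 1 ℕ.≤ b → 0ℚ < Q ^ℕ b - 1ℚ
  0<^ℕ-1 {b} 1≤b = p<q⇒0<q-p (^ℕ-monoʳ-< {0} {b} 1≤b)

  factor-*-denominator : ∀ a {b} → 1 ℕ.≤ b → factor a b * (Q ^ℕ b - 1ℚ) ≡ Q ^ℕ a - 1ℚ
  factor-*-denominator a 1≤b = ÷'-*-cancelʳ _ _ (pos⇒≢0 (0<^ℕ-1 1≤b))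

  -- (q^a - 1) ≥ q^(a-b) (q^b - 1), since the difference is q^(a-b) - 1.
  ^ℕ-∸-≤-factor : ∀ a b → 1 ℕ.≤ b → b ℕ.≤ a → Q ^ℕ (a ℕ.∸ b) ≤ factor a b
  ^ℕ-∸-≤-factor a b 1≤b b≤a =
    *-cancelʳ-≤-pos′ (Q ^ℕ b - 1ℚ) (0<^ℕ-1 1≤b)
      (ℚₚ.≤-trans cleared (ℚₚ.≤-reflexive (sym (factor-*-denominator a 1≤b))))
    where
    c = a ℕ.∸ b
    cleared : Q ^ℕ c * (Q ^ℕ b - 1ℚ) ≤ Q ^ℕ a - 1ℚ
    cleared = begin
      Q ^ℕ c * (Q ^ℕ b - 1ℚ) ≡⟨ solve 2 (λ x y → y :* (x :- con 1ℚ) := x :* y :- y) refl (Q ^ℕ b) (Q ^ℕ c) ⟩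
      Q ^ℕ b * Q ^ℕ c - Q ^ℕ c ≤⟨ ℚₚ.+-monoʳ-≤ (Q ^ℕ b * Q ^ℕ c) (ℚₚ.neg-antimono-≤ (1≤^ℕ c)) ⟩
      Q ^ℕ b * Q ^ℕ c - 1ℚ     ≡⟨ cong (_- 1ℚ) (^ℕ-distribˡ-+-* b c) ⟨
      Q ^ℕ (b ℕ.+ c) - 1ℚ      ≡⟨ cong (λ m → Q ^ℕ m - 1ℚ) (ℕₚ.m+[n∸m]≡n b≤a) ⟩
      Q ^ℕ a - 1ℚ              ∎
      where open ℚₚ.≤-Reasoning

  factor-pos : ∀ a b → 1 ℕ.≤ b → b ℕ.≤ a → 0ℚ < factor a b
  factor-pos a b 1≤b b≤a = ℚₚ.<-≤-trans (^ℕ-pos (a ℕ.∸ b)) (^ℕ-∸-≤-factor a b 1≤b b≤a)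

  factor-monoˡ-≤ : ∀ {a a'} b → 1 ℕ.≤ b → a ℕ.≤ a' → factor a b ≤ factor a' b
  factor-monoˡ-≤ {a} {a'} b 1≤b a≤a' = *-cancelʳ-≤-pos′ (Q ^ℕ b - 1ℚ) (0<^ℕ-1 1≤b)
    (subst₂ _≤_ (sym (factor-*-denominator a 1≤b)) (sym (factor-*-denominator a' 1≤b))
      (ℚₚ.+-monoˡ-≤ (- 1ℚ) (^ℕ-monoʳ-≤ a≤a')))

  gaussℕ-pos : ∀ M K → K ℕ.≤ M → 0ℚ < gaussℕ M K
  gaussℕ-pos M zero _ = ℚₚ.positive⁻¹ 1ℚ
  gaussℕ-pos (suc M) (suc K) (ℕ.s≤s K≤M) = subst (0ℚ <_) (sym (gaussℕ-suc M K))
    (*-pos (factor-pos (suc M) (suc K) (ℕ.s≤s ℕ.z≤n) (ℕ.s≤s K≤M)) (gaussℕ-pos M K K≤M))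

  gaussℕ-nonNeg : ∀ M K → K ℕ.≤ M → 0ℚ ≤ gaussℕ M K
  gaussℕ-nonNeg M K K≤M = ℚₚ.<⇒≤ (gaussℕ-pos M K K≤M)

  ^ℕ-*-gaussℕ-≤-shift : ∀ j M K → K ℕ.≤ M →
    Q ^ℕ (j ℕ.* (M ℕ.∸ K)) * gaussℕ M K ≤ gaussℕ (j ℕ.+ M) (j ℕ.+ K)
  ^ℕ-*-gaussℕ-≤-shift zero M K K≤M = ℚₚ.≤-reflexive (ℚₚ.*-identityˡ (gaussℕ M K))
  ^ℕ-*-gaussℕ-≤-shift (suc j) M K K≤M = begin
    Q ^ℕ (M ℕ.∸ K ℕ.+ j ℕ.* (M ℕ.∸ K)) * gaussℕ M K
      ≡⟨ cong (_* gaussℕ M K) (^ℕ-distribˡ-+-* (M ℕ.∸ K) _) ⟩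
    Q ^ℕ (M ℕ.∸ K) * Q ^ℕ (j ℕ.* (M ℕ.∸ K)) * gaussℕ M K
      ≡⟨ ℚₚ.*-assoc (Q ^ℕ (M ℕ.∸ K)) (Q ^ℕ (j ℕ.* (M ℕ.∸ K))) (gaussℕ M K) ⟩
    Q ^ℕ (M ℕ.∸ K) * (Q ^ℕ (j ℕ.* (M ℕ.∸ K)) * gaussℕ M K)
      ≤⟨ *-mono-≤-nonNeg (^ℕ-nonNeg (M ℕ.∸ K)) (*-nonNeg (^ℕ-nonNeg (j ℕ.* (M ℕ.∸ K))) (gaussℕ-nonNeg M K K≤M))
                         leading (^ℕ-*-gaussℕ-≤-shift j M K K≤M) ⟩
    factor (suc (j ℕ.+ M)) (suc (j ℕ.+ K)) * gaussℕ (j ℕ.+ M) (j ℕ.+ K)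
      ≡⟨ gaussℕ-suc (j ℕ.+ M) (j ℕ.+ K) ⟨
    gaussℕ (suc (j ℕ.+ M)) (suc (j ℕ.+ K)) ∎
    where
    open ℚₚ.≤-Reasoning
    leading : Q ^ℕ (M ℕ.∸ K) ≤ factor (suc (j ℕ.+ M)) (suc (j ℕ.+ K))
    leading = subst (λ m → Q ^ℕ m ≤ factor (suc (j ℕ.+ M)) (suc (j ℕ.+ K))) (ℕₚ.[m+n]∸[m+o]≡n∸o j M K)
      (^ℕ-∸-≤-factor (suc (j ℕ.+ M)) (suc (j ℕ.+ K)) (ℕ.s≤s ℕ.z≤n) (ℕ.s≤s (ℕₚ.+-monoʳ-≤ j K≤M)))

  gaussℕ-≤-shift : ∀ j M K → K ℕ.≤ M → gaussℕ M K ≤ gaussℕ (j ℕ.+ M) (j ℕ.+ K)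
  gaussℕ-≤-shift j M K K≤M = ℚₚ.≤-trans
    (subst (_≤ Q ^ℕ (j ℕ.* (M ℕ.∸ K)) * gaussℕ M K) (ℚₚ.*-identityˡ (gaussℕ M K))
      (*-monoʳ-≤-nonNeg′ (gaussℕ M K) (gaussℕ-nonNeg M K K≤M) (1≤^ℕ (j ℕ.* (M ℕ.∸ K)))))
    (^ℕ-*-gaussℕ-≤-shift j M K K≤M)

  gaussℕ-monoˡ-≤ : ∀ j M K → K ℕ.≤ M → gaussℕ M K ≤ gaussℕ (j ℕ.+ M) K
  gaussℕ-monoˡ-≤ j M zero _ = ℚₚ.≤-refl
  gaussℕ-monoˡ-≤ j (suc M) (suc K) (ℕ.s≤s K≤M) = begin
    gaussℕ (suc M) (suc K)
      ≡⟨ gaussℕ-suc M K ⟩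
    factor (suc M) (suc K) * gaussℕ M K
      ≤⟨ *-mono-≤-nonNeg (ℚₚ.<⇒≤ (factor-pos _ _ (ℕ.s≤s ℕ.z≤n) (ℕ.s≤s K≤M))) (gaussℕ-nonNeg M K K≤M)
           (factor-monoˡ-≤ (suc K) (ℕ.s≤s ℕ.z≤n) (ℕ.s≤s (ℕₚ.m≤n+m M j))) (gaussℕ-monoˡ-≤ j M K K≤M) ⟩
    factor (suc (j ℕ.+ M)) (suc K) * gaussℕ (j ℕ.+ M) K
      ≡⟨ gaussℕ-suc (j ℕ.+ M) K ⟨
    gaussℕ (suc (j ℕ.+ M)) (suc K)
      ≡⟨ cong (λ m → gaussℕ m (suc K)) (ℕₚ.+-suc j M) ⟨
    gaussℕ (j ℕ.+ suc M) (suc K) ∎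
    where open ℚₚ.≤-Reasoning

module ExponentInequalities where
  open import Data.Nat
  open import Data.Nat.Properties
  open import Data.Nat.Combinatorics using (nCk+nC[k+1]≡[n+1]C[k+1]; nC1≡n)
  open import Data.Nat.Tactic.RingSolver using (solve-∀)
  open ≡-Reasoning

  [1+i]C2≡i+iC2 : ∀ i → suc i C 2 ≡ i + i C 2
  [1+i]C2≡i+iC2 i = trans (sym (nCk+nC[k+1]≡[n+1]C[k+1] i 1)) (cong (_+ i C 2) (nC1≡n i))

  iC2*2+i≡i*i : ∀ i → (i C 2) * 2 + i ≡ i * i
  iC2*2+i≡i*i zero = refl
  iC2*2+i≡i*i (suc i) = begin
    (suc i C 2) * 2 + suc i         ≡⟨ cong (λ c → c * 2 + suc i) ([1+i]C2≡i+iC2 i) ⟩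
    (i + i C 2) * 2 + suc i         ≡⟨ rearrange i (i C 2) ⟩
    (i C 2) * 2 + i + (2 * i + 1)   ≡⟨ cong (_+ (2 * i + 1)) (iC2*2+i≡i*i i) ⟩
    i * i + (2 * i + 1)             ≡⟨ square i ⟩
    suc i * suc i                   ∎
    where
    rearrange : ∀ i c → (i + c) * 2 + suc i ≡ c * 2 + i + (2 * i + 1)
    rearrange = solve-∀
    square : ∀ i → i * i + (2 * i + 1) ≡ suc i * suc i
    square = solve-∀

  -- As 2 C(i,2) = i² - i, each inequality below becomes, after doubling, a polynomial identity with explicit slack.
  ≤-by-double : ∀ {m n} s → m * 2 + s ≡ n * 2 → m ≤ n
  ≤-by-double {m} {n} s eq = *-cancelʳ-≤ m n 2 (subst (m * 2 ≤_) eq (m≤m+n (m * 2) s))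

  iC2+2k≤1+ki : ∀ {i k} → 2 ≤ i → i < k → i C 2 + (k + k) ≤ 1 + k * i
  iC2+2k≤1+ki 2≤i i<k with m≤n⇒∃[o]m+o≡n 2≤i
  ... | a , refl with m≤n⇒∃[o]m+o≡n i<k
  ... | y , refl = ≤-by-double slack (+-cancelʳ-≡ i _ _ doubled)
    where
    i = 2 + a
    k = suc i + y
    slack = 3 * a + a * a + 2 * a * y
    rearrange : ∀ c k s i → (c + (k + k)) * 2 + s + i ≡ c * 2 + i + (4 * k + s)
    rearrange = solve-∀
    polynomial : ∀ a y → (2 + a) * (2 + a) + (4 * (3 + a + y) + (3 * a + a * a + 2 * a * y))
                         ≡ (1 + (3 + a + y) * (2 + a)) * 2 + (2 + a)
    polynomial = solve-∀
    doubled : (i C 2 + (k + k)) * 2 + slack + i ≡ (1 + k * i) * 2 + i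
    doubled = begin
      (i C 2 + (k + k)) * 2 + slack + i  ≡⟨ rearrange (i C 2) k slack i ⟩
      (i C 2) * 2 + i + (4 * k + slack)  ≡⟨ cong (_+ (4 * k + slack)) (iC2*2+i≡i*i i) ⟩
      i * i + (4 * k + slack)            ≡⟨ polynomial a y ⟩
      (1 + k * i) * 2 + i                ∎

  b-exponent-gap : ∀ {i d k n} → 2 ≤ i → i ≤ d → d < k → 2 * k ≤ n →
    k * i + (d ∸ i) * (d ∸ i) + 1
      ≤ k * 1 + (d ∸ 1) * (d ∸ 1) + (i ∸ 1) * ((n ∸ d ∸ i) ∸ (d ∸ i)) + suc i C 2
  b-exponent-gap 2≤i i≤d d<k 2k≤n with m≤n⇒∃[o]m+o≡n 2≤i
  ... | a , refl with m≤n⇒∃[o]m+o≡n i≤d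
  ... | x , refl with m≤n⇒∃[o]m+o≡n d<k
  ... | y , refl with m≤n⇒∃[o]m+o≡n 2k≤n
  ... | z , refl = subst₂ _≤_ (cong (λ u → k * i + u * u + 1) (sym d∸i≡x))
                              (cong (λ u → R₀ + suc a * u + suc i C 2) (sym gap≡))
                              (≤-by-double slack (+-cancelʳ-≡ i _ _ doubled))
    where
    i = 2 + a
    d = i + x
    k = suc d + y
    n = 2 * k + z
    R₀ = k * 1 + suc (a + x) * suc (a + x)
    slack = 4 + 2 * z + 2 * y + 2 * x + 5 * a + 2 * a * z + 2 * a * y + 2 * a * x + a * a
    d∸i≡x : d ∸ i ≡ x
    d∸i≡x = m+n∸m≡n i x
    gap≡ : n ∸ d ∸ i ∸ (d ∸ i) ≡ 2 + 2 * y + z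
    gap≡ = begin
      n ∸ d ∸ i ∸ (d ∸ i)                   ≡⟨ cong (n ∸ d ∸ i ∸_) d∸i≡x ⟩
      n ∸ d ∸ i ∸ x                         ≡⟨ cong (_∸ x) (∸-+-assoc n d i) ⟩
      n ∸ (d + i) ∸ x                       ≡⟨ ∸-+-assoc n (d + i) x ⟩
      n ∸ (d + i + x)                       ≡⟨ cong (_∸ (d + i + x)) (n≡ a x y z) ⟩
      2 + 2 * y + z + (d + i + x) ∸ (d + i + x) ≡⟨ m+n∸n≡m (2 + 2 * y + z) (d + i + x) ⟩
      2 + 2 * y + z                         ∎
      where
      n≡ : ∀ a x y z → 2 * (3 + a + x + y) + z ≡ 2 + 2 * y + z + ((2 + a + x) + (2 + a) + x)
      n≡ = solve-∀
    polynomial : ∀ a x y z →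
      ((3 + a + x + y) * (2 + a) + x * x + 1) * 2
        + (4 + 2 * z + 2 * y + 2 * x + 5 * a + 2 * a * z + 2 * a * y + 2 * a * x + a * a) + (2 + a)
      ≡ ((3 + a + x + y) * 1 + (1 + a + x) * (1 + a + x) + (1 + a) * (2 + 2 * y + z) + (2 + a)) * 2
        + (2 + a) * (2 + a)
    polynomial = solve-∀
    rearrange : ∀ R i c → R * 2 + (c * 2 + i) ≡ (R + c) * 2 + i
    rearrange = solve-∀
    R = R₀ + suc a * (2 + 2 * y + z)
    R+i+iC2≡R+[1+i]C2 : R + i + i C 2 ≡ R + suc i C 2
    R+i+iC2≡R+[1+i]C2 = trans (+-assoc R i (i C 2)) (cong (λ u → R + u) (sym ([1+i]C2≡i+iC2 i)))
    doubled : (k * i + x * x + 1) * 2 + slack + i ≡ (R + suc i C 2) * 2 + i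
    doubled = begin
      (k * i + x * x + 1) * 2 + slack + i  ≡⟨ polynomial a x y z ⟩
      (R + i) * 2 + i * i                  ≡⟨ cong (λ u → (R + i) * 2 + u) (iC2*2+i≡i*i i) ⟨
      (R + i) * 2 + ((i C 2) * 2 + i)      ≡⟨ rearrange (R + i) i (i C 2) ⟩
      (R + i + i C 2) * 2 + i              ≡⟨ cong (λ u → u * 2 + i) R+i+iC2≡R+[1+i]C2 ⟩
      (R + suc i C 2) * 2 + i              ∎

primePower⇒2≤ : ∀ {q} → IsPrimePower q → 2 ℕ.≤ q
primePower⇒2≤ (p , m , p-prime , 1≤m , refl) = ℕₚ.≤-trans (ℕ.nonTrivial⇒n>1 p {{prime⇒nonTrivial p-prime}})
  (ℕₚ.≤-trans (ℕₚ.≤-reflexive (sym (ℕₚ.*-identityʳ p))) (ℕₚ.^-monoʳ-≤ p {{prime⇒nonZero p-prime}} 1≤m))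
  where open import Data.Nat.Primality using (prime⇒nonTrivial; prime⇒nonZero)

module Coefficients (q i d k n : ℕ) (2≤q : 2 ℕ.≤ q) (2≤i : 2 ℕ.≤ i) (i≤d : i ℕ.≤ d)
                    (d<k : d ℕ.< k) (2k≤n : 2 ℕ.* k ℕ.≤ n) where
  open import Data.Rational using (_+_; _*_; _-_; -_; _≤_; _<_)
  open import Data.Nat.Coprimality using (1-coprimeTo) renaming (sym to coprime-sym)
  open RationalLemmas
  open ExponentInequalities using (iC2+2k≤1+ki; b-exponent-gap)
  open +-*-Solver

  Q : ℚ
  Q = ℚof q

  2≤Q : 1ℚ + 1ℚ ≤ Q
  2≤Q = subst (1ℚ + 1ℚ ≤_) (sym (ℚₚ.normalize-coprime (coprime-sym (1-coprimeTo q))))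
          (ℚ.*≤* (subst (+ 2 ℤ.≤_) (sym (ℤₚ.*-identityʳ (+ q))) (ℤ.+≤+ 2≤q)))

  1<Q : 1ℚ < Q
  1<Q = ℚₚ.<-≤-trans (ℚ.*<* (ℤ.+<+ (ℕ.s≤s (ℕ.s≤s ℕ.z≤n)))) 2≤Q

  open Powers Q 1<Q

  ^ℕ+^ℕ≤^ℕ-suc : ∀ m → Q ^ℕ m + Q ^ℕ m ≤ Q ^ℕ suc m
  ^ℕ+^ℕ≤^ℕ-suc m = subst (_≤ Q ^ℕ suc m) (solve 1 (λ x → (con 1ℚ :+ con 1ℚ) :* x := x :+ x) refl (Q ^ℕ m))
    (*-monoʳ-≤-nonNeg′ (Q ^ℕ m) (^ℕ-nonNeg m) 2≤Q)

  N : ℕ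
  N = n ℕ.∸ k

  private
    1≤i : 1 ℕ.≤ i
    1≤i = ℕₚ.≤-trans (ℕ.s≤s ℕ.z≤n) 2≤i
    d≤k : d ℕ.≤ k
    d≤k = ℕₚ.<⇒≤ d<k
    i≤k : i ℕ.≤ k
    i≤k = ℕₚ.≤-trans i≤d d≤k
    i<k : i ℕ.< k
    i<k = ℕₚ.≤-<-trans i≤d d<k
    2≤d : 2 ℕ.≤ d
    2≤d = ℕₚ.≤-trans 2≤i i≤d
    1≤d : 1 ℕ.≤ d
    1≤d = ℕₚ.≤-trans (ℕ.s≤s ℕ.z≤n) 2≤d
    1≤k : 1 ℕ.≤ k
    1≤k = ℕₚ.≤-trans 1≤d d≤k
    k+k≤n : k ℕ.+ k ℕ.≤ n
    k+k≤n = subst (ℕ._≤ n) (cong (k ℕ.+_) (ℕₚ.+-identityʳ k)) 2k≤n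
    k≤n : k ℕ.≤ n
    k≤n = ℕₚ.≤-trans (ℕₚ.m≤m+n k k) k+k≤n
    k<n : k ℕ.< n
    k<n = ℕₚ.<-≤-trans (ℕₚ.m<m+n k 1≤k) k+k≤n
    k≤N : k ℕ.≤ N
    k≤N = ℕₚ.m+n≤o⇒m≤o∸n k k+k≤n
    1≤N : 1 ℕ.≤ N
    1≤N = ℕₚ.≤-trans 1≤k k≤N
    i≤N : i ℕ.≤ N
    i≤N = ℕₚ.≤-trans i≤k k≤N
    k≤n∸d : k ℕ.≤ n ℕ.∸ d
    k≤n∸d = ℕₚ.m+n≤o⇒m≤o∸n k (ℕₚ.≤-trans (ℕₚ.+-monoʳ-≤ k d≤k) k+k≤n)
    d≤n∸d : d ℕ.≤ n ℕ.∸ d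
    d≤n∸d = ℕₚ.≤-trans d≤k k≤n∸d
    i≤n∸d : i ℕ.≤ n ℕ.∸ d
    i≤n∸d = ℕₚ.≤-trans i≤d d≤n∸d
    k∸d≤n∸d∸j : ∀ j → j ℕ.≤ k → k ℕ.∸ d ℕ.≤ n ℕ.∸ d ℕ.∸ j
    k∸d≤n∸d∸j j j≤k = ℕₚ.m+n≤o⇒m≤o∸n (k ℕ.∸ d) (begin
      k ℕ.∸ d ℕ.+ j  ≤⟨ ℕₚ.+-monoʳ-≤ (k ℕ.∸ d) j≤k ⟩
      k ℕ.∸ d ℕ.+ k  ≡⟨ ℕₚ.+-∸-comm k d≤k ⟨
      k ℕ.+ k ℕ.∸ d  ≤⟨ ℕₚ.∸-monoˡ-≤ d k+k≤n ⟩
      n ℕ.∸ d        ∎)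
      where open ℕₚ.≤-Reasoning
    [j∸1]+[A∸j]≡A∸1 : ∀ {j A} → 1 ℕ.≤ j → j ℕ.≤ A → (j ℕ.∸ 1) ℕ.+ (A ℕ.∸ j) ≡ A ℕ.∸ 1
    [j∸1]+[A∸j]≡A∸1 {suc j} {suc A} _ (ℕ.s≤s j≤A) = ℕₚ.m+[n∸m]≡n j≤A

  -- w = q^(-k) and X = q^(C(i,2) - ki), written exactly as they occur in aj.
  c κ w X D h₁ hᵢ s : ℚ
  c = (Q ^ℕ k - Q ^ℕ d) ÷' (Q ^ℕ n - Q ^ℕ k)
  κ = c * factor N k
  w = Q ^ℤ (+ (1 C 2) ℤ.- + (k ℕ.* 1))
  X = Q ^ℤ (+ (i C 2) ℤ.- + (k ℕ.* i))
  D = Q ^ℕ k * (Q ^ℕ k - 1ℚ)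
  h₁ = gaussℕ (N ℕ.∸ 1) (k ℕ.∸ 1)
  hᵢ = gaussℕ (N ℕ.∸ i) (k ℕ.∸ i)
  s = (- 1ℚ) ^ℕ i

  gauss[n-k,k]≡ : gauss Q (+ n ℤ.- + k) k ≡ factor N k * h₁
  gauss[n-k,k]≡ = trans (gauss-∸ k k≤n k≤N) (gaussℕ-unfold 1≤k k≤N)

  a₁≡ : aj q d k n 1 ≡ κ * h₁ - w * h₁
  a₁≡ = begin
    aj q d k n 1
      ≡⟨ cong₂ (λ u v → c * u + (- 1ℚ) * 1ℚ * w * v) gauss[n-k,k]≡
               (gauss-∸-∸ (k ℕ.∸ 1) k≤n 1≤N (ℕₚ.∸-monoˡ-≤ 1 k≤N)) ⟩
    c * (factor N k * h₁) + (- 1ℚ) * 1ℚ * w * h₁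
      ≡⟨ solve 4 (λ c r h w → c :* (r :* h) :+ con (- 1ℚ) :* con 1ℚ :* w :* h := c :* r :* h :- w :* h)
               refl c (factor N k) h₁ w ⟩
    κ * h₁ - w * h₁ ∎
    where open ≡-Reasoning

  aᵢ≡ : aj q d k n i ≡ κ * h₁ + s * X * hᵢ
  aᵢ≡ = begin
    aj q d k n i
      ≡⟨ cong₂ (λ u v → c * u + s * X * v) gauss[n-k,k]≡
               (gauss-∸-∸ (k ℕ.∸ i) k≤n i≤N (ℕₚ.∸-monoˡ-≤ i k≤N)) ⟩
    c * (factor N k * h₁) + s * X * hᵢ
      ≡⟨ cong (_+ s * X * hᵢ) (ℚₚ.*-assoc c (factor N k) h₁) ⟨
    κ * h₁ + s * X * hᵢ ∎
    where open ≡-Reasoning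

  κ*D≡ : κ * D ≡ Q ^ℕ k - Q ^ℕ d
  κ*D≡ = begin
    c * factor N k * (Q ^ℕ k * (Q ^ℕ k - 1ℚ))
      ≡⟨ solve 3 (λ c r p → c :* r :* (p :* (p :- con 1ℚ)) := c :* (p :* (r :* (p :- con 1ℚ))))
               refl c (factor N k) (Q ^ℕ k) ⟩
    c * (Q ^ℕ k * (factor N k * (Q ^ℕ k - 1ℚ)))
      ≡⟨ cong (λ u → c * (Q ^ℕ k * u)) (factor-*-denominator N 1≤k) ⟩
    c * (Q ^ℕ k * (Q ^ℕ N - 1ℚ))
      ≡⟨ cong (c *_) (solve 2 (λ p m → p :* (m :- con 1ℚ) := m :* p :- p) refl (Q ^ℕ k) (Q ^ℕ N)) ⟩
    c * (Q ^ℕ N * Q ^ℕ k - Q ^ℕ k)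
      ≡⟨ cong (λ u → c * (u - Q ^ℕ k))
              (trans (cong (Q ^ℕ_) (sym (ℕₚ.m∸n+n≡m k≤n))) (^ℕ-distribˡ-+-* N k)) ⟨
    c * (Q ^ℕ n - Q ^ℕ k)
      ≡⟨ ÷'-*-cancelʳ _ _ (pos⇒≢0 (p<q⇒0<q-p (^ℕ-monoʳ-< k<n))) ⟩
    Q ^ℕ k - Q ^ℕ d ∎
    where open ≡-Reasoning

  w*D≡ : w * D ≡ Q ^ℕ k - 1ℚ
  w*D≡ = begin
    w * (Q ^ℕ k * (Q ^ℕ k - 1ℚ)) ≡⟨ ℚₚ.*-assoc w (Q ^ℕ k) _ ⟨
    w * Q ^ℕ k * (Q ^ℕ k - 1ℚ)
      ≡⟨ cong (_* (Q ^ℕ k - 1ℚ)) (^ℤ-*-^ℕ-cong (+ (1 C 2) ℤ.- + (k ℕ.* 1)) (+ 0) k 0 exponent) ⟩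
    1ℚ * 1ℚ * (Q ^ℕ k - 1ℚ)      ≡⟨ ℚₚ.*-identityˡ (Q ^ℕ k - 1ℚ) ⟩
    Q ^ℕ k - 1ℚ                  ∎
    where
    open ≡-Reasoning
    cancel : ∀ (K : ℤ) → + 0 ℤ.- K ℤ.+ K ≡ + 0 ℤ.+ + 0
    cancel = ℤ-Ring.solve-∀
    exponent : + (1 C 2) ℤ.- + (k ℕ.* 1) ℤ.+ + k ≡ + 0 ℤ.+ + 0
    exponent = subst (λ m → + 0 ℤ.- + m ℤ.+ + k ≡ + 0 ℤ.+ + 0) (sym (ℕₚ.*-identityʳ k)) (cancel (+ k))

  0<D : 0ℚ < D
  0<D = *-pos (^ℕ-pos k) (0<^ℕ-1 1≤k)

  0<κ : 0ℚ < κ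
  0<κ = *-pos (÷'-pos (p<q⇒0<q-p (^ℕ-monoʳ-< d<k)) (p<q⇒0<q-p (^ℕ-monoʳ-< k<n)))
              (factor-pos N k 1≤k k≤N)

  κ<w : κ < w
  κ<w = *-cancelʳ-<-pos′ D 0<D (subst₂ _<_ (sym κ*D≡) (sym w*D≡)
          (ℚₚ.+-monoʳ-< (Q ^ℕ k) (ℚₚ.neg-antimono-< (^ℕ-monoʳ-< {0} {d} 1≤d))))

  w<κ+κ : w < κ + κ
  w<κ+κ = *-cancelʳ-<-pos′ D 0<D
    (0<q-p⇒p<q (subst (0ℚ <_) (sym difference) (ℚₚ.<-≤-trans (ℚₚ.positive⁻¹ 1ℚ) (p≤p+q 1ℚ 0≤gap))))
    where
    0≤gap : 0ℚ ≤ Q ^ℕ k - (Q ^ℕ d + Q ^ℕ d)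
    0≤gap = p≤q⇒0≤q-p (ℚₚ.≤-trans (^ℕ+^ℕ≤^ℕ-suc d) (^ℕ-monoʳ-≤ d<k))
    difference : (κ + κ) * D - w * D ≡ 1ℚ + (Q ^ℕ k - (Q ^ℕ d + Q ^ℕ d))
    difference = begin
      (κ + κ) * D - w * D
        ≡⟨ solve 3 (λ a b d → (a :+ a) :* d :- b := a :* d :+ a :* d :- b) refl κ (w * D) D ⟩
      κ * D + κ * D - w * D
        ≡⟨ cong₂ (λ u v → u + u - v) κ*D≡ w*D≡ ⟩
      (Q ^ℕ k - Q ^ℕ d) + (Q ^ℕ k - Q ^ℕ d) - (Q ^ℕ k - 1ℚ)
        ≡⟨ solve 2 (λ a b → (a :- b) :+ (a :- b) :- (a :- con 1ℚ) := con 1ℚ :+ (a :- (b :+ b)))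
                 refl (Q ^ℕ k) (Q ^ℕ d) ⟩
      1ℚ + (Q ^ℕ k - (Q ^ℕ d + Q ^ℕ d)) ∎
      where open ≡-Reasoning

  X<κ : X < κ
  X<κ = *-cancelʳ-<-pos′ (Q ^ℕ (k ℕ.+ k)) (^ℕ-pos (k ℕ.+ k)) (begin-strict
    X * Q ^ℕ (k ℕ.+ k)            ≤⟨ X*q^[k+k]≤q ⟩
    Q ^ℕ 1                        <⟨ ^ℕ-monoʳ-< 2≤d ⟩
    Q ^ℕ d                        ≤⟨ q^d≤q^k-q^d ⟩
    Q ^ℕ k - Q ^ℕ d               ≡⟨ κ*D≡ ⟨
    κ * (Q ^ℕ k * (Q ^ℕ k - 1ℚ))  ≤⟨ *-monoˡ-≤-nonNeg′ κ (ℚₚ.<⇒≤ 0<κ) (*-monoˡ-≤-nonNeg′ (Q ^ℕ k) (^ℕ-nonNeg k) p-1≤p) ⟩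
    κ * (Q ^ℕ k * Q ^ℕ k)         ≡⟨ cong (κ *_) (^ℕ-distribˡ-+-* k k) ⟨
    κ * Q ^ℕ (k ℕ.+ k)            ∎)
    where
    open ℚₚ.≤-Reasoning
    rearrange : ∀ (C K L : ℤ) → C ℤ.- K ℤ.+ L ℤ.+ K ≡ C ℤ.+ L
    rearrange = ℤ-Ring.solve-∀
    X*q^[k+k]≤q : X * Q ^ℕ (k ℕ.+ k) ≤ Q ^ℕ 1
    X*q^[k+k]≤q = subst (X * Q ^ℕ (k ℕ.+ k) ≤_) (ℚₚ.*-identityʳ (Q ^ℕ 1))
      (^ℤ-*-^ℕ-mono (+ (i C 2) ℤ.- + (k ℕ.* i)) (+ 1) (k ℕ.+ k) 0
        (≤-via-+ {m = k ℕ.* i} (rearrange (+ (i C 2)) (+ (k ℕ.* i)) (+ (k ℕ.+ k))) refl (iC2+2k≤1+ki 2≤i i<k)))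
    q^d≤q^k-q^d : Q ^ℕ d ≤ Q ^ℕ k - Q ^ℕ d
    q^d≤q^k-q^d = subst (_≤ Q ^ℕ k - Q ^ℕ d) (solve 1 (λ x → x :+ x :- x := x) refl (Q ^ℕ d))
      (ℚₚ.+-monoˡ-≤ (- Q ^ℕ d) (ℚₚ.≤-trans (^ℕ+^ℕ≤^ℕ-suc d) (^ℕ-monoʳ-≤ d<k)))
    p-1≤p : Q ^ℕ k - 1ℚ ≤ Q ^ℕ k
    p-1≤p = subst (Q ^ℕ k - 1ℚ ≤_) (ℚₚ.+-identityʳ (Q ^ℕ k))
      (ℚₚ.+-monoʳ-≤ (Q ^ℕ k) (ℚₚ.neg-antimono-≤ (ℚₚ.<⇒≤ (ℚₚ.positive⁻¹ 1ℚ))))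

  0<h₁ : 0ℚ < h₁
  0<h₁ = gaussℕ-pos (N ℕ.∸ 1) (k ℕ.∸ 1) (ℕₚ.∸-monoˡ-≤ 1 k≤N)

  hᵢ≤h₁ : hᵢ ≤ h₁
  hᵢ≤h₁ = subst₂ (λ u v → hᵢ ≤ gaussℕ u v) ([j∸1]+[A∸j]≡A∸1 1≤i i≤N) ([j∸1]+[A∸j]≡A∸1 1≤i i≤k)
            (gaussℕ-≤-shift (i ℕ.∸ 1) (N ℕ.∸ i) (k ℕ.∸ i) (ℕₚ.∸-monoˡ-≤ i k≤N))

  0<X : 0ℚ < X
  0<X = ^ℤ-pos (+ (i C 2) ℤ.- + (k ℕ.* i))

  0≤X*hᵢ : 0ℚ ≤ X * hᵢ
  0≤X*hᵢ = *-nonNeg (ℚₚ.<⇒≤ 0<X) (gaussℕ-nonNeg (N ℕ.∸ i) (k ℕ.∸ i) (ℕₚ.∸-monoˡ-≤ i k≤N))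

  X*hᵢ<κ*h₁ : X * hᵢ < κ * h₁
  X*hᵢ<κ*h₁ = ℚₚ.≤-<-trans (*-monoˡ-≤-nonNeg′ X (ℚₚ.<⇒≤ 0<X) hᵢ≤h₁) (*-monoˡ-<-pos′ h₁ 0<h₁ X<κ)

  a₁<0 : aj q d k n 1 < 0ℚ
  a₁<0 = subst₂ _<_ (sym a₁≡) (ℚₚ.+-inverseʳ (w * h₁))
           (ℚₚ.+-monoˡ-< (- (w * h₁)) (*-monoˡ-<-pos′ h₁ 0<h₁ κ<w))

  κ*h₁≤aᵢ : s ≡ 1ℚ → κ * h₁ ≤ aj q d k n i
  κ*h₁≤aᵢ s≡1 = subst (κ * h₁ ≤_) (sym (trans aᵢ≡ (cong (λ t → κ * h₁ + t * X * hᵢ) s≡1)))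
    (p≤p+q (κ * h₁) (subst (0ℚ ≤_) (sym (cong (_* hᵢ) (ℚₚ.*-identityˡ X))) 0≤X*hᵢ))

  0<aᵢ : 0ℚ < aj q d k n i
  0<aᵢ with -1^-cases i
  ... | inj₁ s≡1 = ℚₚ.<-≤-trans (*-pos 0<κ 0<h₁) (κ*h₁≤aᵢ s≡1)
  ... | inj₂ s≡-1 = subst (0ℚ <_) (sym (trans aᵢ≡ (cong (λ t → κ * h₁ + t * X * hᵢ) s≡-1)))
    (subst (0ℚ <_) (solve 3 (λ a x h → a :- x :* h := a :+ con (- 1ℚ) :* x :* h) refl (κ * h₁) X hᵢ)
      (p<q⇒0<q-p X*hᵢ<κ*h₁))

  -a₁<aᵢ : s ≡ 1ℚ → - aj q d k n 1 < aj q d k n i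
  -a₁<aᵢ s≡1 = ℚₚ.<-≤-trans -a₁<κ*h₁ (κ*h₁≤aᵢ s≡1)
    where
    w-κ<κ : w - κ < κ
    w-κ<κ = subst (w - κ <_) (solve 1 (λ a → a :+ a :- a := a) refl κ) (ℚₚ.+-monoˡ-< (- κ) w<κ+κ)
    -a₁<κ*h₁ : - aj q d k n 1 < κ * h₁
    -a₁<κ*h₁ = subst (_< κ * h₁)
      (trans (solve 3 (λ w a h → (w :- a) :* h := :- (a :* h :- w :* h)) refl w κ h₁) (cong -_ (sym a₁≡)))
      (*-monoˡ-<-pos′ h₁ 0<h₁ w-κ<κ)

  eᵇ : ℕ → ℤ
  eᵇ j = + (k ℕ.* j) ℤ.+ (+ d ℤ.- + j) ℤ.* (+ d ℤ.- + j) ℤ.- + (suc j C 2)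

  B : ℕ → ℚ
  B j = Q ^ℤ eᵇ j * gaussℕ (k ℕ.∸ j) (d ℕ.∸ j) * gaussℕ (n ℕ.∸ d ℕ.∸ j) (d ℕ.∸ j)
                  * gaussℕ (n ℕ.∸ d ℕ.∸ j) (k ℕ.∸ d)

  b≡ : ∀ j → j ℕ.≤ d → bj q d k n j ≡ (- 1ℚ) ^ℕ j * B j
  b≡ j j≤d = begin
    bj q d k n j
      ≡⟨ cong₂ (λ u v → σ * E * u * v * gauss Q (+ n ℤ.- + d ℤ.- + j) (k ℕ.∸ d))
               (gauss-∸ (d ℕ.∸ j) j≤k (ℕₚ.∸-monoˡ-≤ j d≤k))
               (gauss-∸-∸ (d ℕ.∸ j) d≤n j≤n∸d (ℕₚ.∸-monoˡ-≤ j d≤n∸d)) ⟩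
    σ * E * G₁ * G₂ * gauss Q (+ n ℤ.- + d ℤ.- + j) (k ℕ.∸ d)
      ≡⟨ cong (σ * E * G₁ * G₂ *_) (gauss-∸-∸ (k ℕ.∸ d) d≤n j≤n∸d (k∸d≤n∸d∸j j j≤k)) ⟩
    σ * E * G₁ * G₂ * G₃
      ≡⟨ solve 5 (λ s e a b c → s :* e :* a :* b :* c := s :* (e :* a :* b :* c)) refl σ E G₁ G₂ G₃ ⟩
    σ * B j ∎
    where
    open ≡-Reasoning
    σ = (- 1ℚ) ^ℕ j
    E = Q ^ℤ eᵇ j
    G₁ = gaussℕ (k ℕ.∸ j) (d ℕ.∸ j)
    G₂ = gaussℕ (n ℕ.∸ d ℕ.∸ j) (d ℕ.∸ j)
    G₃ = gaussℕ (n ℕ.∸ d ℕ.∸ j) (k ℕ.∸ d)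
    j≤k = ℕₚ.≤-trans j≤d d≤k
    d≤n = ℕₚ.≤-trans d≤k k≤n
    j≤n∸d = ℕₚ.≤-trans j≤d d≤n∸d

  0<B : ∀ j → j ℕ.≤ d → 0ℚ < B j
  0<B j j≤d = *-pos (*-pos (*-pos (^ℤ-pos (eᵇ j))
    (gaussℕ-pos _ _ (ℕₚ.∸-monoˡ-≤ j d≤k)))
    (gaussℕ-pos _ _ (ℕₚ.∸-monoˡ-≤ j d≤n∸d)))
    (gaussℕ-pos _ _ (k∸d≤n∸d∸j j (ℕₚ.≤-trans j≤d d≤k)))

  b₁≡-B₁ : bj q d k n 1 ≡ - B 1
  b₁≡-B₁ = trans (b≡ 1 1≤d) (solve 1 (λ b → con (- 1ℚ) :* con 1ℚ :* b := :- b) refl (B 1))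

  b₁<0 : bj q d k n 1 < 0ℚ
  b₁<0 = subst (_< 0ℚ) (sym b₁≡-B₁) (ℚₚ.neg-antimono-< (0<B 1 1≤d))

  -- The factor q^T, gained by shifting the middle Gaussian binomial, absorbs the growth of the exponent eᵇ.
  T : ℕ
  T = (i ℕ.∸ 1) ℕ.* ((n ℕ.∸ d ℕ.∸ i) ℕ.∸ (d ℕ.∸ i))

  q^eᵢ≤q^e₁*q^T : Q ^ℤ eᵇ i ≤ Q ^ℤ eᵇ 1 * Q ^ℕ T
  q^eᵢ≤q^e₁*q^T = subst (_≤ Q ^ℤ eᵇ 1 * Q ^ℕ T) (ℚₚ.*-identityʳ (Q ^ℤ eᵇ i))
    (^ℤ-*-^ℕ-mono (eᵇ i) (eᵇ 1) 0 T
      (≤-via-+ {m = suc i C 2 ℕ.+ 1} eᵢ≡ e₁≡ (b-exponent-gap 2≤i i≤d d<k 2k≤n)))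
    where
    square≡ : ∀ j → j ℕ.≤ d → (+ d ℤ.- + j) ℤ.* (+ d ℤ.- + j) ≡ + ((d ℕ.∸ j) ℕ.* (d ℕ.∸ j))
    square≡ j j≤d = trans (cong₂ ℤ._*_ (+m-+n≡+[m∸n] j≤d) (+m-+n≡+[m∸n] j≤d))
                          (sym (ℤₚ.pos-* (d ℕ.∸ j) (d ℕ.∸ j)))
    ringᵢ : ∀ (K U C : ℤ) → K ℤ.+ U ℤ.- C ℤ.+ + 0 ℤ.+ (C ℤ.+ + 1) ≡ K ℤ.+ U ℤ.+ + 1
    ringᵢ = ℤ-Ring.solve-∀
    ring₁ : ∀ (K V S C : ℤ) → K ℤ.+ V ℤ.- + 1 ℤ.+ S ℤ.+ (C ℤ.+ + 1) ≡ K ℤ.+ V ℤ.+ S ℤ.+ C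
    ring₁ = ℤ-Ring.solve-∀
    eᵢ≡ : eᵇ i ℤ.+ + 0 ℤ.+ + (suc i C 2 ℕ.+ 1) ≡ + (k ℕ.* i ℕ.+ (d ℕ.∸ i) ℕ.* (d ℕ.∸ i) ℕ.+ 1)
    eᵢ≡ = trans (cong (λ u → + (k ℕ.* i) ℤ.+ u ℤ.- + (suc i C 2) ℤ.+ + 0 ℤ.+ + (suc i C 2 ℕ.+ 1)) (square≡ i i≤d))
                (ringᵢ (+ (k ℕ.* i)) (+ ((d ℕ.∸ i) ℕ.* (d ℕ.∸ i))) (+ (suc i C 2)))
    e₁≡ : eᵇ 1 ℤ.+ + T ℤ.+ + (suc i C 2 ℕ.+ 1)
          ≡ + (k ℕ.* 1 ℕ.+ (d ℕ.∸ 1) ℕ.* (d ℕ.∸ 1) ℕ.+ T ℕ.+ suc i C 2)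
    e₁≡ = trans (cong (λ u → + (k ℕ.* 1) ℤ.+ u ℤ.- + 1 ℤ.+ + T ℤ.+ + (suc i C 2 ℕ.+ 1)) (square≡ 1 1≤d))
                (ring₁ (+ (k ℕ.* 1)) (+ ((d ℕ.∸ 1) ℕ.* (d ℕ.∸ 1))) (+ T) (+ (suc i C 2)))

  Bᵢ≤B₁ : B i ≤ B 1
  Bᵢ≤B₁ = begin
    Eᵢ * Gᵢ₁ * Gᵢ₂ * Gᵢ₃
      ≤⟨ *-monoʳ-≤-nonNeg′ Gᵢ₃ 0≤Gᵢ₃ (*-monoʳ-≤-nonNeg′ Gᵢ₂ 0≤Gᵢ₂ (*-monoʳ-≤-nonNeg′ Gᵢ₁ 0≤Gᵢ₁ q^eᵢ≤q^e₁*q^T)) ⟩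
    E₁ * Q ^ℕ T * Gᵢ₁ * Gᵢ₂ * Gᵢ₃
      ≡⟨ solve 5 (λ e p a b c → e :* p :* a :* b :* c := e :* a :* (p :* b) :* c) refl E₁ (Q ^ℕ T) Gᵢ₁ Gᵢ₂ Gᵢ₃ ⟩
    E₁ * Gᵢ₁ * (Q ^ℕ T * Gᵢ₂) * Gᵢ₃
      ≤⟨ *-mono-≤-nonNeg (*-nonNeg (*-nonNeg 0≤E₁ 0≤Gᵢ₁) (*-nonNeg (^ℕ-nonNeg T) 0≤Gᵢ₂)) 0≤Gᵢ₃
           (*-mono-≤-nonNeg (*-nonNeg 0≤E₁ 0≤Gᵢ₁) (*-nonNeg (^ℕ-nonNeg T) 0≤Gᵢ₂)
              (*-monoˡ-≤-nonNeg′ E₁ 0≤E₁ Gᵢ₁≤G₁₁) q^T*Gᵢ₂≤G₁₂)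
           Gᵢ₃≤G₁₃ ⟩
    E₁ * G₁₁ * G₁₂ * G₁₃ ∎
    where
    open ℚₚ.≤-Reasoning
    Eᵢ = Q ^ℤ eᵇ i
    E₁ = Q ^ℤ eᵇ 1
    Gᵢ₁ = gaussℕ (k ℕ.∸ i) (d ℕ.∸ i)
    Gᵢ₂ = gaussℕ (n ℕ.∸ d ℕ.∸ i) (d ℕ.∸ i)
    Gᵢ₃ = gaussℕ (n ℕ.∸ d ℕ.∸ i) (k ℕ.∸ d)
    G₁₁ = gaussℕ (k ℕ.∸ 1) (d ℕ.∸ 1)
    G₁₂ = gaussℕ (n ℕ.∸ d ℕ.∸ 1) (d ℕ.∸ 1)
    G₁₃ = gaussℕ (n ℕ.∸ d ℕ.∸ 1) (k ℕ.∸ d)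
    0≤E₁ = ℚₚ.<⇒≤ (^ℤ-pos (eᵇ 1))
    0≤Gᵢ₁ = gaussℕ-nonNeg _ _ (ℕₚ.∸-monoˡ-≤ i d≤k)
    0≤Gᵢ₂ = gaussℕ-nonNeg _ _ (ℕₚ.∸-monoˡ-≤ i d≤n∸d)
    0≤Gᵢ₃ = gaussℕ-nonNeg _ _ (k∸d≤n∸d∸j i i≤k)
    Gᵢ₁≤G₁₁ : Gᵢ₁ ≤ G₁₁
    Gᵢ₁≤G₁₁ = subst₂ (λ u v → Gᵢ₁ ≤ gaussℕ u v) ([j∸1]+[A∸j]≡A∸1 1≤i i≤k) ([j∸1]+[A∸j]≡A∸1 1≤i i≤d)
      (gaussℕ-≤-shift (i ℕ.∸ 1) (k ℕ.∸ i) (d ℕ.∸ i) (ℕₚ.∸-monoˡ-≤ i d≤k))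
    q^T*Gᵢ₂≤G₁₂ : Q ^ℕ T * Gᵢ₂ ≤ G₁₂
    q^T*Gᵢ₂≤G₁₂ = subst₂ (λ u v → Q ^ℕ T * Gᵢ₂ ≤ gaussℕ u v)
      ([j∸1]+[A∸j]≡A∸1 1≤i i≤n∸d) ([j∸1]+[A∸j]≡A∸1 1≤i i≤d)
      (^ℕ-*-gaussℕ-≤-shift (i ℕ.∸ 1) (n ℕ.∸ d ℕ.∸ i) (d ℕ.∸ i) (ℕₚ.∸-monoˡ-≤ i d≤n∸d))
    Gᵢ₃≤G₁₃ : Gᵢ₃ ≤ G₁₃
    Gᵢ₃≤G₁₃ = subst (λ u → Gᵢ₃ ≤ gaussℕ u (k ℕ.∸ d)) ([j∸1]+[A∸j]≡A∸1 1≤i i≤n∸d)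
      (gaussℕ-monoˡ-≤ (i ℕ.∸ 1) (n ℕ.∸ d ℕ.∸ i) (k ℕ.∸ d) (k∸d≤n∸d∸j i i≤k))

  bᵢ-cases : bj q d k n i ≤ 0ℚ ⊎ (bj q d k n i ≤ - bj q d k n 1 × - aj q d k n 1 < aj q d k n i)
  bᵢ-cases with -1^-cases i
  ... | inj₁ s≡1 = inj₂ (subst₂ _≤_ (sym bᵢ≡Bᵢ) B₁≡-b₁ Bᵢ≤B₁ , -a₁<aᵢ s≡1)
    where
    bᵢ≡Bᵢ : bj q d k n i ≡ B i
    bᵢ≡Bᵢ = trans (b≡ i i≤d) (trans (cong (_* B i) s≡1) (ℚₚ.*-identityˡ (B i)))
    B₁≡-b₁ : B 1 ≡ - bj q d k n 1
    B₁≡-b₁ = trans (solve 1 (λ b → b := :- (:- b)) refl (B 1)) (cong -_ (sym b₁≡-B₁))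
  ... | inj₂ s≡-1 = inj₁ (subst (_≤ 0ℚ) (sym bᵢ≡-Bᵢ) (ℚₚ.neg-antimono-≤ (ℚₚ.<⇒≤ (0<B i i≤d))))
    where
    bᵢ≡-Bᵢ : bj q d k n i ≡ - B i
    bᵢ≡-Bᵢ = trans (b≡ i i≤d)
      (trans (cong (_* B i) s≡-1) (solve 1 (λ b → con (- 1ℚ) :* b := :- b) refl (B i)))

open import Data.Nat using (ℕ; _≤_; _<_; _*_)
open import Data.Rational using () renaming (_<_ to _<ℚ_; _*_ to _*ℚ_)

lemmaA5 : (q i d k n : ℕ) → IsPrimePower q → 2 ≤ i → i ≤ d → d < k → 2 * k ≤ n →
    bj q d k n i <ℚ ((aj q d k n i *ℚ bj q d k n 1) ÷' aj q d k n 1)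
lemmaA5 q i d k n q-prime-power 2≤i i≤d d<k 2k≤n = <-÷'-neg a₁<0 b₁<0 0<aᵢ bᵢ-cases
  where
  open RationalLemmas using (<-÷'-neg)
  open Coefficients q i d k n (primePower⇒2≤ q-prime-power) 2≤i i≤d d<k 2k≤n
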